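{- Let $I$ be a finite linear ordering with $m=|I|\ge2$ elements listed increasingly as $\xi(0)<\dots<\xi(m-1)$. Let $A$ and $F(\xi)$, $\xi\in I$, be pairwise disjoint sets, let $E=A\cup\bigcup_{\xi\in I}F(\xi)$, and let $\le$ be a partial ordering on a set containing $E$. Then the depletion $\ll_I$ of $\le$ given by $I$, $A$ and $(F(\xi))_{\xi\in I}$ is a partial ordering on $E$, and $x\ll_I y$ implies $x\le y$ for all $x,y\in E$.
   Context: Depletion: for $x,y\in E$, $x\ll_I y$ iff $x\le y$ and one of the following holds: (1) $x,y\in A\cup F(\xi)$ for some $\xi\in I$; (2) there are $i<j$ with $x\in F(\xi(i))$, $y\in F(\xi(j))$, and either (a) there is $a\in A$ with $x\le a\le y$, or (b) there are $x_l\in F(\xi(i+l))$ for $0\le l\le j-i$ with $x_0=x$, $x_{j-i}=y$ and $x_l\le x_{l+1}$ for all $l<j-i$; (3) there are $i>j$ with $x\in F(\xi(i))$, $y\in F(\xi(j))$, and either (a) there is $a\in A$ with $x\le a\le y$, or (b) there are $x_l\in F(\xi(j+l))$ for $0\le l\le i-j$ with $x_0=y$, $x_{i-j}=x$ and $x_l\ge x_{l+1}$ for all $l<i-j$. -}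

module Defs where

open import Level using (Level; _⊔_)
open import Data.Nat using (ℕ; suc; _≤_)
open import Data.Fin using (Fin; toℕ)
open import Data.Product using (Σ; _×_; ∃)
open import Data.Sum using (_⊎_)
open import Relation.Binary.Core using (Rel)
open import Relation.Binary.PropositionalEquality using (_≡_)
open import Relation.Unary using (Pred)

-- A finite sequence x_0 ≤' x_1 ≤' … indexed by the positions lo, lo+1, …, hi
-- of the enumeration ξ, with x_l ∈ F(ξ(lo+l)).  The sequence is represented
-- as a function c on positions (only its values at lo..hi matter).
record Chain {a b ℓ₁ ℓ₂ : Level} {X : Set a} {I : Set b} {m : ℕ}
             (R : Rel X ℓ₁) (F : I → Pred X ℓ₂) (ξ : Fin m → I)
             (lo hi : Fin m) (start end : X) : Set (a ⊔ ℓ₁ ⊔ ℓ₂) where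
  field
    seq     : Fin m → X
    seq-lo  : seq lo ≡ start
    seq-hi  : seq hi ≡ end
    seq-mem : ∀ k → toℕ lo ≤ toℕ k → toℕ k ≤ toℕ hi → F (ξ k) (seq k)
    seq-rel : ∀ k k' → toℕ lo ≤ toℕ k → toℕ k' ≡ suc (toℕ k) → toℕ k' ≤ toℕ hi →
              R (seq k) (seq k')

module _ {a b ℓ₁ ℓ₂ ℓ₃ : Level} {X : Set a} {I : Set b} {m : ℕ}
         (_≤X_ : Rel X ℓ₁) (ξ : Fin m → I) (A : Pred X ℓ₂) (F : I → Pred X ℓ₃) where

  private
    _≥X_ : Rel X ℓ₁
    x ≥X y = y ≤X x

    through-A : X → X → Set (a ⊔ ℓ₁ ⊔ ℓ₂)
    through-A x y = Σ X λ z → A z × x ≤X z × z ≤X y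

  Clause1 : X → X → Set (b ⊔ ℓ₂ ⊔ ℓ₃)
  Clause1 x y = Σ I λ η → (A x ⊎ F η x) × (A y ⊎ F η y)

  Clause2 : X → X → Set (a ⊔ ℓ₁ ⊔ ℓ₂ ⊔ ℓ₃)
  Clause2 x y = Σ (Fin m) λ i → Σ (Fin m) λ j →
    suc (toℕ i) ≤ toℕ j × F (ξ i) x × F (ξ j) y ×
    (through-A x y ⊎ Chain {I = I} _≤X_ F ξ i j x y)

  Clause3 : X → X → Set (a ⊔ ℓ₁ ⊔ ℓ₂ ⊔ ℓ₃)
  Clause3 x y = Σ (Fin m) λ i → Σ (Fin m) λ j →
    suc (toℕ j) ≤ toℕ i × F (ξ i) x × F (ξ j) y ×
    (through-A x y ⊎ Chain {I = I} _≥X_ F ξ j i y x)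

  Depletion : X → X → Set (a ⊔ b ⊔ ℓ₁ ⊔ ℓ₂ ⊔ ℓ₃)
  Depletion x y = x ≤X y × (Clause1 x y ⊎ Clause2 x y ⊎ Clause3 x y)

E : {a b ℓ₂ ℓ₃ : Level} {X : Set a} {I : Set b} → Pred X ℓ₂ → (I → Pred X ℓ₃) → X → Set (b ⊔ ℓ₂ ⊔ ℓ₃)
E {I = I} A F x = A x ⊎ Σ I λ η → F η x

-- Reflexivity and antisymmetry are inherited from ≤, clause (1) supplying
-- reflexivity.  For transitivity take x ≪ y ≪ z with x, z at levels i < k and
-- let j be the level of y.  If y ∈ A it is a witness for (2a).  If i < j < k
-- the witnesses of x ≪ y and y ≪ z glue: two chains concatenate at level j,
-- and a point of A on either side serves for the whole stretch.  If j ≤ i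
-- (dually k ≤ j), the witness of y ≪ z already spans [i, k]; a chain is
-- increasing, so it can be cut down to [i, k] and its first value replaced by
-- x ≤ y.  The case i > k is the same argument for ≥.
module Submission where

open import Defs
open import Level using (Level; _⊔_)
open import Data.Nat using (ℕ; _≤_; _<_)
open import Data.Fin using (Fin; toℕ)
open import Function.Definitions using (Bijective)
open import Relation.Nullary using (¬_)
open import Relation.Binary.Core using (Rel)
open import Data.Product using (_×_)
open import Relation.Binary.Structures using (IsPartialOrder; IsStrictTotalOrder)
open import Relation.Binary.PropositionalEquality using (_≡_)
open import Relation.Unary using (Pred)

open import Data.Nat using (zero; suc; _+_; s≤s; _≤?_; s≤s⁻¹)
open import Data.Nat.Properties
  using (≤-refl; ≤-trans; ≤-antisym; ≤-reflexive; <-trans; <-≤-trans; ≤-<-trans; <⇒≤; <⇒≱;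
         ≰⇒>; <-irrefl; <-asym; <-cmp; n<1+n; m≤n+m; m∸n+n≡m)
open import Data.Fin using (zero; fromℕ<; _≟_)
open import Data.Fin.Properties using (toℕ-injective; toℕ-fromℕ<; toℕ<n)
open import Data.Product using (Σ; _,_; proj₁; proj₂)
open import Data.Sum using (_⊎_; inj₁; inj₂; map₁)
open import Data.Empty using (⊥-elim)
open import Function using (flip)
open import Relation.Nullary using (yes; no)
open import Relation.Binary.Definitions using (Reflexive; Transitive; tri<; tri≈; tri>)
open import Relation.Binary.PropositionalEquality using (refl; sym; trans; cong; subst)

Through : ∀ {a ℓ₁ ℓ₂} {X : Set a} → Rel X ℓ₁ → Pred X ℓ₂ → Rel X (a ⊔ ℓ₁ ⊔ ℓ₂)
Through {X = X} R A p q = Σ X λ t → A t × R p t × R t q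

Through-flip : ∀ {a ℓ₁ ℓ₂} {X : Set a} {R : Rel X ℓ₁} {A : Pred X ℓ₂} {p q : X} →
               Through R A p q → Through (flip R) A q p
Through-flip (t , t∈A , pRt , tRq) = t , t∈A , tRq , pRt

module ChainOperations {a b ℓ₁ ℓ₂ : Level} {X : Set a} {I : Set b} {m : ℕ}
  {R : Rel X ℓ₁} (R-refl : Reflexive R) (R-trans : Transitive R)
  {F : I → Pred X ℓ₂} {ξ : Fin m → I} where

  open Chain

  Ch : Fin m → Fin m → X → X → Set (a ⊔ ℓ₁ ⊔ ℓ₂)
  Ch = Chain {I = I} R F ξ

  private
    seq-mono-by : ∀ {lo hi s e} (c : Ch lo hi s e) n {k l} → toℕ l ≡ n + toℕ k →
                  toℕ lo ≤ toℕ k → toℕ l ≤ toℕ hi → R (seq c k) (seq c l)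
    seq-mono-by c zero l≡k _ _ with toℕ-injective l≡k
    ... | refl = R-refl
    seq-mono-by {lo} {hi} c (suc n) {k} {l} l≡1+n+k lo≤k l≤hi =
      R-trans (seq-mono-by c n (toℕ-fromℕ< n+k<m) lo≤k k′≤hi) (seq-rel c k′ l lo≤k′ l≡1+k′ l≤hi)
      where
        n+k<m : n + toℕ k < m
        n+k<m = <-trans (n<1+n _) (subst (_< m) l≡1+n+k (toℕ<n l))
        k′ : Fin m
        k′ = fromℕ< n+k<m
        l≡1+k′ : toℕ l ≡ suc (toℕ k′)
        l≡1+k′ = trans l≡1+n+k (cong suc (sym (toℕ-fromℕ< n+k<m)))
        lo≤k′ : toℕ lo ≤ toℕ k′
        lo≤k′ = subst (toℕ lo ≤_) (sym (toℕ-fromℕ< n+k<m)) (≤-trans lo≤k (m≤n+m _ n))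
        k′≤hi : toℕ k′ ≤ toℕ hi
        k′≤hi = <⇒≤ (<-≤-trans (≤-reflexive (sym l≡1+k′)) l≤hi)

  seq-mono : ∀ {lo hi s e} (c : Ch lo hi s e) {k l} → toℕ lo ≤ toℕ k → toℕ k ≤ toℕ l →
             toℕ l ≤ toℕ hi → R (seq c k) (seq c l)
  seq-mono c lo≤k k≤l = seq-mono-by c _ (sym (m∸n+n≡m k≤l)) lo≤k

  start-R-seq : ∀ {lo hi s e} (c : Ch lo hi s e) {l} → toℕ lo ≤ toℕ l → toℕ l ≤ toℕ hi →
                R s (seq c l)
  start-R-seq c {l} lo≤l l≤hi =
    subst (λ t → R t (seq c l)) (seq-lo c) (seq-mono c ≤-refl lo≤l l≤hi)

  seq-R-end : ∀ {lo hi s e} (c : Ch lo hi s e) {l} → toℕ lo ≤ toℕ l → toℕ l ≤ toℕ hi →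
              R (seq c l) e
  seq-R-end c {l} lo≤l l≤hi = subst (R (seq c l)) (seq-hi c) (seq-mono c lo≤l l≤hi ≤-refl)

  trimˡ : ∀ {lo hi s e lo′ w} (c : Ch lo hi s e) → toℕ lo ≤ toℕ lo′ → toℕ lo′ < toℕ hi →
          F (ξ lo′) w → R w s → Ch lo′ hi w e
  trimˡ {hi = hi} {e = e} {lo′ = lo′} {w = w} c lo≤lo′ lo′<hi w∈F wRs = record
    { seq = sq ; seq-lo = sq-lo ; seq-hi = sq-hi ; seq-mem = sq-mem ; seq-rel = sq-rel }
    where
      sq : Fin m → X
      sq k with k ≟ lo′
      ... | yes _ = w
      ... | no  _ = seq c k
      sq-lo : sq lo′ ≡ w
      sq-lo with lo′ ≟ lo′
      ... | yes _    = refl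
      ... | no  lo′≢lo′ = ⊥-elim (lo′≢lo′ refl)
      sq-hi : sq hi ≡ e
      sq-hi with hi ≟ lo′
      ... | yes refl = ⊥-elim (<-irrefl refl lo′<hi)
      ... | no  _    = seq-hi c
      sq-mem : ∀ k → toℕ lo′ ≤ toℕ k → toℕ k ≤ toℕ hi → F (ξ k) (sq k)
      sq-mem k lo′≤k k≤hi with k ≟ lo′
      ... | yes refl = w∈F
      ... | no  _    = seq-mem c k (≤-trans lo≤lo′ lo′≤k) k≤hi
      sq-rel : ∀ k k′ → toℕ lo′ ≤ toℕ k → toℕ k′ ≡ suc (toℕ k) → toℕ k′ ≤ toℕ hi →
               R (sq k) (sq k′)
      sq-rel k k′ lo′≤k k′≡1+k k′≤hi with k ≟ lo′ | k′ ≟ lo′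
      ... | _        | yes refl = ⊥-elim (<⇒≱ (≤-reflexive (sym k′≡1+k)) lo′≤k)
      ... | yes refl | no  _    =
        R-trans (R-trans wRs (start-R-seq c lo≤lo′ (<⇒≤ lo′<hi)))
                (seq-rel c k k′ lo≤lo′ k′≡1+k k′≤hi)
      ... | no  _    | no  _    = seq-rel c k k′ (≤-trans lo≤lo′ lo′≤k) k′≡1+k k′≤hi

  trimʳ : ∀ {lo hi s e hi′ w} (c : Ch lo hi s e) → toℕ hi′ ≤ toℕ hi → toℕ lo < toℕ hi′ →
          F (ξ hi′) w → R e w → Ch lo hi′ s w
  trimʳ {lo = lo} {s = s} {hi′ = hi′} {w = w} c hi′≤hi lo<hi′ w∈F eRw = record
    { seq = sq ; seq-lo = sq-lo ; seq-hi = sq-hi ; seq-mem = sq-mem ; seq-rel = sq-rel }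
    where
      sq : Fin m → X
      sq k with k ≟ hi′
      ... | yes _ = w
      ... | no  _ = seq c k
      sq-lo : sq lo ≡ s
      sq-lo with lo ≟ hi′
      ... | yes refl = ⊥-elim (<-irrefl refl lo<hi′)
      ... | no  _    = seq-lo c
      sq-hi : sq hi′ ≡ w
      sq-hi with hi′ ≟ hi′
      ... | yes _       = refl
      ... | no  hi′≢hi′ = ⊥-elim (hi′≢hi′ refl)
      sq-mem : ∀ k → toℕ lo ≤ toℕ k → toℕ k ≤ toℕ hi′ → F (ξ k) (sq k)
      sq-mem k lo≤k k≤hi′ with k ≟ hi′
      ... | yes refl = w∈F
      ... | no  _    = seq-mem c k lo≤k (≤-trans k≤hi′ hi′≤hi)
      sq-rel : ∀ k k′ → toℕ lo ≤ toℕ k → toℕ k′ ≡ suc (toℕ k) → toℕ k′ ≤ toℕ hi′ →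
               R (sq k) (sq k′)
      sq-rel k k′ lo≤k k′≡1+k k′≤hi′ with k ≟ hi′ | k′ ≟ hi′
      ... | yes refl | _        = ⊥-elim (<⇒≱ (≤-reflexive (sym k′≡1+k)) k′≤hi′)
      ... | no  _    | yes refl =
        R-trans (seq-rel c k k′ lo≤k k′≡1+k hi′≤hi) (R-trans (seq-R-end c (<⇒≤ lo<hi′) hi′≤hi) eRw)
      ... | no  _    | no  _    = seq-rel c k k′ lo≤k k′≡1+k (≤-trans k′≤hi′ hi′≤hi)

  concat : ∀ {lo mid hi p q r} → Ch lo mid p q → Ch mid hi q r →
           toℕ lo ≤ toℕ mid → toℕ mid < toℕ hi → Ch lo hi p r
  concat {lo} {mid} {hi} {p} {r = r} c d lo≤mid mid<hi = record
    { seq = sq ; seq-lo = sq-lo ; seq-hi = sq-hi ; seq-mem = sq-mem ; seq-rel = sq-rel }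
    where
      sq : Fin m → X
      sq k with toℕ k ≤? toℕ mid
      ... | yes _ = seq c k
      ... | no  _ = seq d k
      sq-lo : sq lo ≡ p
      sq-lo with toℕ lo ≤? toℕ mid
      ... | yes _      = seq-lo c
      ... | no  lo≰mid = ⊥-elim (lo≰mid lo≤mid)
      sq-hi : sq hi ≡ r
      sq-hi with toℕ hi ≤? toℕ mid
      ... | yes hi≤mid = ⊥-elim (<⇒≱ mid<hi hi≤mid)
      ... | no  _      = seq-hi d
      sq-mem : ∀ k → toℕ lo ≤ toℕ k → toℕ k ≤ toℕ hi → F (ξ k) (sq k)
      sq-mem k lo≤k k≤hi with toℕ k ≤? toℕ mid
      ... | yes k≤mid = seq-mem c k lo≤k k≤mid
      ... | no  k≰mid = seq-mem d k (<⇒≤ (≰⇒> k≰mid)) k≤hi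
      sq-rel : ∀ k k′ → toℕ lo ≤ toℕ k → toℕ k′ ≡ suc (toℕ k) → toℕ k′ ≤ toℕ hi →
               R (sq k) (sq k′)
      sq-rel k k′ lo≤k k′≡1+k k′≤hi with toℕ k ≤? toℕ mid | toℕ k′ ≤? toℕ mid
      ... | yes _     | yes k′≤mid = seq-rel c k k′ lo≤k k′≡1+k k′≤mid
      ... | yes k≤mid | no  k′≰mid = across-mid (toℕ-injective (≤-antisym k≤mid mid≤k))
        where
          mid≤k : toℕ mid ≤ toℕ k
          mid≤k = s≤s⁻¹ (subst (toℕ mid <_) k′≡1+k (≰⇒> k′≰mid))
          across-mid : k ≡ mid → R (seq c k) (seq d k′)
          across-mid refl = subst (λ t → R t (seq d k′)) (trans (seq-lo d) (sym (seq-hi c)))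
                              (seq-rel d k k′ ≤-refl k′≡1+k k′≤hi)
      ... | no  k≰mid | yes k′≤mid = ⊥-elim (k≰mid (<⇒≤ (subst (_≤ toℕ mid) k′≡1+k k′≤mid)))
      ... | no  k≰mid | no  _      = seq-rel d k k′ (<⇒≤ (≰⇒> k≰mid)) k′≡1+k k′≤hi

  module _ {ℓ} (A : Pred X ℓ) where

    Link : Fin m → Fin m → Rel X (a ⊔ ℓ₁ ⊔ ℓ₂ ⊔ ℓ)
    Link lo hi p q = Through R A p q ⊎ Ch lo hi p q

    Link-trimˡ : ∀ {j lo hi p q r} → Link j hi q r → toℕ j ≤ toℕ lo → toℕ lo < toℕ hi →
                 F (ξ lo) p → R p q → Link lo hi p r
    Link-trimˡ (inj₁ (t , t∈A , qRt , tRr)) _ _ _ pRq = inj₁ (t , t∈A , R-trans pRq qRt , tRr)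
    Link-trimˡ (inj₂ d) j≤lo lo<hi p∈F pRq = inj₂ (trimˡ d j≤lo lo<hi p∈F pRq)

    Link-trimʳ : ∀ {lo j hi p q r} → Link lo j p q → toℕ hi ≤ toℕ j → toℕ lo < toℕ hi →
                 F (ξ hi) r → R q r → Link lo hi p r
    Link-trimʳ (inj₁ (t , t∈A , pRt , tRq)) _ _ _ qRr = inj₁ (t , t∈A , pRt , R-trans tRq qRr)
    Link-trimʳ (inj₂ c) hi≤j lo<hi r∈F qRr = inj₂ (trimʳ c hi≤j lo<hi r∈F qRr)

    Link-concat : ∀ {lo j hi p q r} → Link lo j p q → Link j hi q r →
                  toℕ lo < toℕ j → toℕ j < toℕ hi → R p q → R q r → Link lo hi p r
    Link-concat (inj₁ (t , t∈A , pRt , tRq)) _ _ _ _ qRr = inj₁ (t , t∈A , pRt , R-trans tRq qRr)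
    Link-concat (inj₂ _) (inj₁ (t , t∈A , qRt , tRr)) _ _ pRq _ =
      inj₁ (t , t∈A , R-trans pRq qRt , tRr)
    Link-concat (inj₂ c) (inj₂ d) lo<j j<hi _ _ = inj₂ (concat c d (<⇒≤ lo<j) j<hi)

    Link-trans : ∀ {ℓS} (S : Rel X ℓS) → (∀ {u v} → S u v → R u v) →
                 (∀ {u v i j} → S u v → F (ξ i) u → F (ξ j) v → toℕ i < toℕ j → Link i j u v) →
                 ∀ {lo hi p q r} → S p q → S q r → F (ξ lo) p → F (ξ hi) r → toℕ lo < toℕ hi →
                 A q ⊎ Σ (Fin m) (λ j → F (ξ j) q) → Link lo hi p r
    Link-trans S S⇒R S⇒Link pSq qSr p∈F r∈F lo<hi (inj₁ q∈A) = inj₁ (_ , q∈A , S⇒R pSq , S⇒R qSr)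
    Link-trans S S⇒R S⇒Link {lo} {hi} pSq qSr p∈F r∈F lo<hi (inj₂ (j , q∈F))
      with toℕ j ≤? toℕ lo | toℕ hi ≤? toℕ j
    ... | yes j≤lo | _ =
      Link-trimˡ (S⇒Link qSr q∈F r∈F (≤-<-trans j≤lo lo<hi)) j≤lo lo<hi p∈F (S⇒R pSq)
    ... | no _ | yes hi≤j =
      Link-trimʳ (S⇒Link pSq p∈F q∈F (<-≤-trans lo<hi hi≤j)) hi≤j lo<hi r∈F (S⇒R qSr)
    ... | no j≰lo | no hi≰j =
      Link-concat (S⇒Link pSq p∈F q∈F lo<j) (S⇒Link qSr q∈F r∈F j<hi) lo<j j<hi (S⇒R pSq) (S⇒R qSr)
      where
        lo<j : toℕ lo < toℕ j
        lo<j = ≰⇒> j≰lo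
        j<hi : toℕ j < toℕ hi
        j<hi = ≰⇒> hi≰j

module DepletionOrder {a b ℓ₁ ℓ₂ ℓ₃ : Level} {X : Set a} {I : Set b} {m : ℕ}
  {_⊑_ : Rel X ℓ₁} (⊑-isPartialOrder : IsPartialOrder _≡_ _⊑_)
  {ξ : Fin m → I} (ξ-bijective : Bijective _≡_ _≡_ ξ)
  {A : Pred X ℓ₂} {F : I → Pred X ℓ₃}
  (A-disjoint : ∀ x η → A x → ¬ F η x)
  (F-disjoint : ∀ x η θ → F η x → F θ x → η ≡ θ)
  (η₀ : I) where

  open IsPartialOrder ⊑-isPartialOrder using ()
    renaming (refl to ⊑-refl; trans to ⊑-trans; antisym to ⊑-antisym)

  module Up = ChainOperations {R = _⊑_} ⊑-refl ⊑-trans {F = F} {ξ = ξ}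
  module Down = ChainOperations {R = flip _⊑_} ⊑-refl (λ y⊑x z⊑y → ⊑-trans z⊑y y⊑x) {F = F} {ξ = ξ}

  _≪_ : Rel X (a ⊔ b ⊔ ℓ₁ ⊔ ℓ₂ ⊔ ℓ₃)
  _≪_ = Depletion _⊑_ ξ A F

  level : ∀ {x} → E A F x → A x ⊎ Σ (Fin m) λ i → F (ξ i) x
  level (inj₁ x∈A) = inj₁ x∈A
  level {x} (inj₂ (η , x∈Fη)) with proj₂ ξ-bijective η
  ... | i , ξi≡η = inj₂ (i , subst (λ θ → F θ x) (sym (ξi≡η refl)) x∈Fη)

  level-unique : ∀ {x i j} → F (ξ i) x → F (ξ j) x → i ≡ j
  level-unique x∈Fi x∈Fj = proj₁ ξ-bijective (F-disjoint _ _ _ x∈Fi x∈Fj)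

  Clause1⇒same-level : ∀ {x y i j} → Clause1 _⊑_ ξ A F x y → F (ξ i) x → F (ξ j) y → i ≡ j
  Clause1⇒same-level (_ , inj₁ x∈A , _) x∈F _ = ⊥-elim (A-disjoint _ _ x∈A x∈F)
  Clause1⇒same-level (_ , inj₂ _ , inj₁ y∈A) _ y∈F = ⊥-elim (A-disjoint _ _ y∈A y∈F)
  Clause1⇒same-level (_ , inj₂ x∈Fη , inj₂ y∈Fη) x∈F y∈F =
    proj₁ ξ-bijective (trans (F-disjoint _ _ _ x∈F x∈Fη) (F-disjoint _ _ _ y∈Fη y∈F))

  ≪⇒Link↑ : ∀ {x y i j} → x ≪ y → F (ξ i) x → F (ξ j) y → toℕ i < toℕ j → Up.Link A i j x y
  ≪⇒Link↑ (_ , inj₁ c₁) x∈F y∈F i<j =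
    ⊥-elim (<-irrefl (cong toℕ (Clause1⇒same-level c₁ x∈F y∈F)) i<j)
  ≪⇒Link↑ (_ , inj₂ (inj₁ (_ , _ , _ , x∈F′ , y∈F′ , link))) x∈F y∈F _
    with level-unique x∈F′ x∈F | level-unique y∈F′ y∈F
  ... | refl | refl = link
  ≪⇒Link↑ (_ , inj₂ (inj₂ (_ , _ , j<i , x∈F′ , y∈F′ , _))) x∈F y∈F i<j
    with level-unique x∈F′ x∈F | level-unique y∈F′ y∈F
  ... | refl | refl = ⊥-elim (<-asym i<j j<i)

  ≪⇒Link↓ : ∀ {x y i j} → y ≪ x → F (ξ j) x → F (ξ i) y → toℕ j < toℕ i → Down.Link A j i x y
  ≪⇒Link↓ (_ , inj₁ c₁) x∈F y∈F j<i =
    ⊥-elim (<-irrefl (cong toℕ (sym (Clause1⇒same-level c₁ y∈F x∈F))) j<i)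
  ≪⇒Link↓ (_ , inj₂ (inj₁ (_ , _ , i<j , y∈F′ , x∈F′ , _))) x∈F y∈F j<i
    with level-unique x∈F′ x∈F | level-unique y∈F′ y∈F
  ... | refl | refl = ⊥-elim (<-asym i<j j<i)
  ≪⇒Link↓ (_ , inj₂ (inj₂ (_ , _ , _ , y∈F′ , x∈F′ , link))) x∈F y∈F _
    with level-unique x∈F′ x∈F | level-unique y∈F′ y∈F
  ... | refl | refl = map₁ (Through-flip {R = _⊑_}) link

  ≪⇒⊑ : ∀ {x y} → x ≪ y → x ⊑ y
  ≪⇒⊑ = proj₁

  ≪-refl : ∀ {x} → E A F x → x ≪ x
  ≪-refl (inj₁ x∈A)        = ⊑-refl , inj₁ (η₀ , inj₁ x∈A , inj₁ x∈A)
  ≪-refl (inj₂ (η , x∈Fη)) = ⊑-refl , inj₁ (η , inj₂ x∈Fη , inj₂ x∈Fη)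

  ≪-antisym : ∀ {x y} → x ≪ y → y ≪ x → x ≡ y
  ≪-antisym x≪y y≪x = ⊑-antisym (≪⇒⊑ x≪y) (≪⇒⊑ y≪x)

  ≪-trans : ∀ {x y z} → E A F x → E A F y → E A F z → x ≪ y → y ≪ z → x ≪ z
  ≪-trans {x} {y} {z} x∈E y∈E z∈E x≪y y≪z =
    ⊑-trans (≪⇒⊑ x≪y) (≪⇒⊑ y≪z) , clause (level x∈E) (level z∈E)
    where
      clause : A x ⊎ Σ (Fin m) (λ i → F (ξ i) x) → A z ⊎ Σ (Fin m) (λ k → F (ξ k) z) →
               Clause1 _⊑_ ξ A F x z ⊎ Clause2 _⊑_ ξ A F x z ⊎ Clause3 _⊑_ ξ A F x z
      clause (inj₁ x∈A)       (inj₁ z∈A)       = inj₁ (η₀ , inj₁ x∈A , inj₁ z∈A)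
      clause (inj₁ x∈A)       (inj₂ (k , z∈F)) = inj₁ (ξ k , inj₁ x∈A , inj₂ z∈F)
      clause (inj₂ (i , x∈F)) (inj₁ z∈A)       = inj₁ (ξ i , inj₂ x∈F , inj₁ z∈A)
      clause (inj₂ (i , x∈F)) (inj₂ (k , z∈F)) with <-cmp (toℕ i) (toℕ k)
      ... | tri< i<k _ _ = inj₂ (inj₁ (i , k , i<k , x∈F , z∈F ,
              Up.Link-trans A _≪_ ≪⇒⊑ ≪⇒Link↑ x≪y y≪z x∈F z∈F i<k (level y∈E)))
      ... | tri≈ _ i≡k _ rewrite toℕ-injective i≡k = inj₁ (ξ k , inj₂ x∈F , inj₂ z∈F)
      ... | tri> _ _ k<i = inj₂ (inj₂ (i , k , k<i , x∈F , z∈F , map₁ (Through-flip {R = flip _⊑_})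
              (Down.Link-trans A (flip _≪_) ≪⇒⊑ ≪⇒Link↓ y≪z x≪y z∈F x∈F k<i (level y∈E))))

lemma3p4 : {a b ℓ₁ ℓ₂ ℓ₃ ℓ₄ : Level} {X : Set a} {I : Set b}
    (_<I_ : Rel I ℓ₄) → IsStrictTotalOrder _≡_ _<I_ →
    (m : ℕ) → 2 ≤ m →
    (ξ : Fin m → I) → Bijective _≡_ _≡_ ξ →
    (∀ i j → toℕ i < toℕ j → ξ i <I ξ j) →
    (A : Pred X ℓ₂) (F : I → Pred X ℓ₃) →
    (∀ x η → A x → ¬ F η x) →
    (∀ x η θ → F η x → F θ x → η ≡ θ) →
    (_≤X_ : Rel X ℓ₁) → IsPartialOrder _≡_ _≤X_ →
    ((∀ x → E A F x → Depletion _≤X_ ξ A F x x)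
     × (∀ x y → E A F x → E A F y → Depletion _≤X_ ξ A F x y → Depletion _≤X_ ξ A F y x → x ≡ y)
     × (∀ x y z → E A F x → E A F y → E A F z →
          Depletion _≤X_ ξ A F x y → Depletion _≤X_ ξ A F y z → Depletion _≤X_ ξ A F x z))
    × (∀ x y → E A F x → E A F y → Depletion _≤X_ ξ A F x y → x ≤X y)
lemma3p4 _ _ _ (s≤s (s≤s _)) ξ ξ-bijective _ A F A-disjoint F-disjoint _ ≤-isPartialOrder =
  ( (λ _ → ≪-refl)
  , (λ _ _ _ _ → ≪-antisym)
  , (λ _ _ _ → ≪-trans) )
  , (λ _ _ _ _ → ≪⇒⊑)
  where open DepletionOrder ≤-isPartialOrder ξ-bijective A-disjoint F-disjoint (ξ zero)
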